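{- Let $G$ and $H$ be short dicotic games. If $G \succ 0$ (modulo the misère dicotic universe), then it is not the case that $G + H + (-H) \prec 0$ (modulo the misère dicotic universe).
   Context: Games are short combinatorial games $G=\{G^{\mathcal L}\mid G^{\mathcal R}\}$ (finitely many distinct subpositions, no infinite run) played under misère convention (the player unable to move wins; equivalently, the last player to move loses). A game is dicotic if every subposition $G'$ (including $G$) satisfies $G'^{\mathcal L}=\emptyset$ iff $G'^{\mathcal R}=\emptyset$. The disjunctive sum is $G+H=\{G^{\mathcal L}+H,\,G+H^{\mathcal L}\mid G^{\mathcal R}+H,\,G+H^{\mathcal R}\}$, and the conjugate is defined recursively by $-G=\{ -G^{\mathcal R}\mid -G^{\mathcal L}\}$. Outcomes are ordered $\mathscr L>\mathscr P,\ \mathscr L>\mathscr N,\ \mathscr P>\mathscr R,\ \mathscr N>\mathscr R$ ($\mathscr P$ and $\mathscr N$ incomparable), where $\mathscr L$: Left wins moving first or second, $\mathscr R$: Right wins either way, $\mathscr N$: the next player wins, $\mathscr P$: the previous player wins. Let $\mathcal D^-$ be the class of all short dicotic games under misère play. For $G,H\in\mathcal D^-$: $G\succcurlyeq H$ iff $o(G+X)\ge o(H+X)$ for all $X\in\mathcal D^-$; $G=H$ iff $o(G+X)=o(H+X)$ for all $X\in\mathcal D^-$; $G\succ H$ means $G\succcurlyeq H$ and $G\ne H$; $G\prec H$ means $H\succ G$. Here $0=\{\,\mid\,\}$. -}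

module Defs where

open import Data.Bool using (Bool; true; false; _∧_; _∨_)
open import Data.List using (List; []; _∷_; _++_)
open import Data.List.Relation.Unary.All using (All)
open import Data.Product using (_×_)
open import Relation.Binary.PropositionalEquality using (_≡_)
open import Relation.Nullary using (¬_)
open import Function.Bundles using (_⇔_)

-- Short games: finite game trees, each position given by its finite lists of
-- Left options and Right options.  Every term of this inductive type is short.
data Game : Set where
  ⟨_∣_⟩ : List Game → List Game → Game

zeroG : Game
zeroG = ⟨ [] ∣ [] ⟩

infixl 6 _⊕_
mutual
  _⊕_ : Game → Game → Game
  G@(⟨ GL ∣ GR ⟩) ⊕ H@(⟨ HL ∣ HR ⟩) =
    ⟨ sumL GL H ++ sumR G HL ∣ sumL GR H ++ sumR G HR ⟩

  sumL : List Game → Game → List Game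
  sumL []       H = []
  sumL (g ∷ gs) H = (g ⊕ H) ∷ sumL gs H

  sumR : Game → List Game → List Game
  sumR G []       = []
  sumR G (h ∷ hs) = (G ⊕ h) ∷ sumR G hs

mutual
  neg : Game → Game
  neg ⟨ GL ∣ GR ⟩ = ⟨ negs GR ∣ negs GL ⟩

  negs : List Game → List Game
  negs []       = []
  negs (g ∷ gs) = neg g ∷ negs gs

data Dicotic : Game → Set where
  dic : ∀ {GL GR} → (GL ≡ [] ⇔ GR ≡ []) → All Dicotic GL → All Dicotic GR →
        Dicotic ⟨ GL ∣ GR ⟩

-- Misère play: a player unable to move wins.
-- leftFirst G  : Left wins G moving first.
-- leftSecond G : Left wins G moving second (Right moves first).
mutual
  leftFirst : Game → Bool
  leftFirst ⟨ [] ∣ GR ⟩     = true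
  leftFirst ⟨ g ∷ gs ∣ GR ⟩ = anyLeftSecond (g ∷ gs)

  anyLeftSecond : List Game → Bool
  anyLeftSecond []       = false
  anyLeftSecond (g ∷ gs) = leftSecond g ∨ anyLeftSecond gs

  leftSecond : Game → Bool
  leftSecond ⟨ GL ∣ [] ⟩     = false
  leftSecond ⟨ GL ∣ r ∷ rs ⟩ = allLeftFirst (r ∷ rs)

  allLeftFirst : List Game → Bool
  allLeftFirst []       = true
  allLeftFirst (r ∷ rs) = leftFirst r ∧ allLeftFirst rs

data Outcome : Set where
  𝓛 𝓝 𝓟 𝓡 : Outcome

outcomeOf : Bool → Bool → Outcome
outcomeOf true  true  = 𝓛
outcomeOf true  false = 𝓝
outcomeOf false true  = 𝓟
outcomeOf false false = 𝓡

o : Game → Outcome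
o G = outcomeOf (leftFirst G) (leftSecond G)

infix 4 _≥ₒ_
data _≥ₒ_ : Outcome → Outcome → Set where
  ≥-refl : ∀ {x} → x ≥ₒ x
  𝓛≥𝓟 : 𝓛 ≥ₒ 𝓟
  𝓛≥𝓝 : 𝓛 ≥ₒ 𝓝
  𝓛≥𝓡 : 𝓛 ≥ₒ 𝓡
  𝓟≥𝓡 : 𝓟 ≥ₒ 𝓡
  𝓝≥𝓡 : 𝓝 ≥ₒ 𝓡

infix 4 _≽_ _≈D_ _≻_ _≺_
_≽_ : Game → Game → Set
G ≽ H = ∀ X → Dicotic X → o (G ⊕ X) ≥ₒ o (H ⊕ X)

_≈D_ : Game → Game → Set
G ≈D H = ∀ X → Dicotic X → o (G ⊕ X) ≡ o (H ⊕ X)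

_≻_ : Game → Game → Set
G ≻ H = (G ≽ H) × ¬ (G ≈D H)

_≺_ : Game → Game → Set
G ≺ H = H ≻ G

-- Write K = H + (−H). If G ≻ 0 then G + K ≽ K, so G + K ≼ 0 would give K ≼ 0.
-- Conjugation reverses ≽ and fixes 0, while −K = (−H) + H is K up to commutativity;
-- hence also K ≽ 0, and then 0 ≽ G + K ≽ K ≽ 0 forces G + K = 0, contradicting G + K ≺ 0.
module Submission where

open import Defs
open import Relation.Nullary using (¬_)
open import Data.Bool using (true; false; not; _∧_; _∨_; T)
open import Data.Bool.Properties using (T-∧; T-∨; T-≡; ⇔→≡; ∨-∧-booleanAlgebra)
open import Algebra.Lattice.Properties.BooleanAlgebra ∨-∧-booleanAlgebra using (deMorgan₁; deMorgan₂)
open import Data.List using (List; []; _∷_; _++_)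
open import Data.List.Properties using (++-assoc; ++-conicalˡ; ++-conicalʳ)
open import Data.List.Relation.Unary.All as All using (All; []; _∷_)
open import Data.List.Relation.Unary.All.Properties as All using ()
open import Data.List.Relation.Unary.Any using (Any; here; there)
open import Data.List.Relation.Unary.Any.Properties as Any using ()
open import Data.List.Relation.Binary.Pointwise as Pointwise using (Pointwise; []; _∷_)
open import Data.Product using (_×_; _,_; proj₁; proj₂; swap)
open import Data.Sum using (inj₁; inj₂; [_,_])
open import Function using (_∘_)
open import Function.Bundles using (_⇔_; mk⇔; Equivalence)
open import Relation.Binary.PropositionalEquality
  using (_≡_; refl; sym; trans; cong; cong₂; subst; subst₂; module ≡-Reasoning)

open Equivalence using (to; from)

sumL-++ : ∀ xs ys H → sumL (xs ++ ys) H ≡ sumL xs H ++ sumL ys H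
sumL-++ []       ys H = refl
sumL-++ (x ∷ xs) ys H = cong (x ⊕ H ∷_) (sumL-++ xs ys H)

sumR-++ : ∀ G xs ys → sumR G (xs ++ ys) ≡ sumR G xs ++ sumR G ys
sumR-++ G []       ys = refl
sumR-++ G (x ∷ xs) ys = cong (G ⊕ x ∷_) (sumR-++ G xs ys)

negs-++ : ∀ xs ys → negs (xs ++ ys) ≡ negs xs ++ negs ys
negs-++ []       ys = refl
negs-++ (x ∷ xs) ys = cong (neg x ∷_) (negs-++ xs ys)

mutual
  ⊕-identityˡ : ∀ G → zeroG ⊕ G ≡ G
  ⊕-identityˡ ⟨ GL ∣ GR ⟩ = cong₂ ⟨_∣_⟩ (sumR-identityˡ GL) (sumR-identityˡ GR)

  sumR-identityˡ : ∀ xs → sumR zeroG xs ≡ xs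
  sumR-identityˡ []       = refl
  sumR-identityˡ (x ∷ xs) = cong₂ _∷_ (⊕-identityˡ x) (sumR-identityˡ xs)

mutual
  ⊕-assoc : ∀ A B C → (A ⊕ B) ⊕ C ≡ A ⊕ (B ⊕ C)
  ⊕-assoc A@(⟨ AL ∣ AR ⟩) B@(⟨ BL ∣ BR ⟩) C@(⟨ CL ∣ CR ⟩) =
    cong₂ ⟨_∣_⟩ (options-assoc A B C AL BL CL) (options-assoc A B C AR BR CR)

  options-assoc : ∀ A B C as bs cs →
    sumL (sumL as B ++ sumR A bs) C ++ sumR (A ⊕ B) cs ≡
    sumL as (B ⊕ C) ++ sumR A (sumL bs C ++ sumR B cs)
  options-assoc A B C as bs cs = begin
      sumL (sumL as B ++ sumR A bs) C ++ sumR (A ⊕ B) cs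
    ≡⟨ cong (_++ sumR (A ⊕ B) cs) (sumL-++ (sumL as B) (sumR A bs) C) ⟩
      (sumL (sumL as B) C ++ sumL (sumR A bs) C) ++ sumR (A ⊕ B) cs
    ≡⟨ ++-assoc (sumL (sumL as B) C) (sumL (sumR A bs) C) (sumR (A ⊕ B) cs) ⟩
      sumL (sumL as B) C ++ (sumL (sumR A bs) C ++ sumR (A ⊕ B) cs)
    ≡⟨ cong₂ _++_ (sumL-assoc as B C)
                  (cong₂ _++_ (sumL-sumR-assoc A bs C) (sumR-assoc A B cs)) ⟩
      sumL as (B ⊕ C) ++ (sumR A (sumL bs C) ++ sumR A (sumR B cs))
    ≡⟨ cong (sumL as (B ⊕ C) ++_) (sym (sumR-++ A (sumL bs C) (sumR B cs))) ⟩
      sumL as (B ⊕ C) ++ sumR A (sumL bs C ++ sumR B cs)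
    ∎
    where open ≡-Reasoning

  sumL-assoc : ∀ as B C → sumL (sumL as B) C ≡ sumL as (B ⊕ C)
  sumL-assoc []       B C = refl
  sumL-assoc (a ∷ as) B C = cong₂ _∷_ (⊕-assoc a B C) (sumL-assoc as B C)

  sumL-sumR-assoc : ∀ A bs C → sumL (sumR A bs) C ≡ sumR A (sumL bs C)
  sumL-sumR-assoc A []       C = refl
  sumL-sumR-assoc A (b ∷ bs) C = cong₂ _∷_ (⊕-assoc A b C) (sumL-sumR-assoc A bs C)

  sumR-assoc : ∀ A B cs → sumR (A ⊕ B) cs ≡ sumR A (sumR B cs)
  sumR-assoc A B []       = refl
  sumR-assoc A B (c ∷ cs) = cong₂ _∷_ (⊕-assoc A B c) (sumR-assoc A B cs)

mutual
  neg-involutive : ∀ G → neg (neg G) ≡ G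
  neg-involutive ⟨ GL ∣ GR ⟩ = cong₂ ⟨_∣_⟩ (negs-involutive GL) (negs-involutive GR)

  negs-involutive : ∀ xs → negs (negs xs) ≡ xs
  negs-involutive []       = refl
  negs-involutive (x ∷ xs) = cong₂ _∷_ (neg-involutive x) (negs-involutive xs)

mutual
  neg-distrib-⊕ : ∀ G H → neg (G ⊕ H) ≡ neg G ⊕ neg H
  neg-distrib-⊕ G@(⟨ GL ∣ GR ⟩) H@(⟨ HL ∣ HR ⟩) =
    cong₂ ⟨_∣_⟩ (negs-options G H GR HR) (negs-options G H GL HL)

  negs-options : ∀ G H gs hs →
    negs (sumL gs H ++ sumR G hs) ≡ sumL (negs gs) (neg H) ++ sumR (neg G) (negs hs)
  negs-options G H gs hs =
    trans (negs-++ (sumL gs H) (sumR G hs)) (cong₂ _++_ (negs-sumL gs H) (negs-sumR G hs))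

  negs-sumL : ∀ gs H → negs (sumL gs H) ≡ sumL (negs gs) (neg H)
  negs-sumL []       H = refl
  negs-sumL (g ∷ gs) H = cong₂ _∷_ (neg-distrib-⊕ g H) (negs-sumL gs H)

  negs-sumR : ∀ G hs → negs (sumR G hs) ≡ sumR (neg G) (negs hs)
  negs-sumR G []       = refl
  negs-sumR G (h ∷ hs) = cong₂ _∷_ (neg-distrib-⊕ G h) (negs-sumR G hs)

sumL-conical : ∀ xs H → sumL xs H ≡ [] → xs ≡ []
sumL-conical []      H _ = refl
sumL-conical (_ ∷ _) H ()

sumR-conical : ∀ G ys → sumR G ys ≡ [] → ys ≡ []
sumR-conical G []      _ = refl
sumR-conical G (_ ∷ _) ()

negs-conical : ∀ xs → negs xs ≡ [] → xs ≡ []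
negs-conical []      _ = refl
negs-conical (_ ∷ _) ()

options-empty⇔ : ∀ {G H xs xs′ ys ys′} → (xs ≡ [] ⇔ xs′ ≡ []) → (ys ≡ [] ⇔ ys′ ≡ []) →
                 (sumL xs H ++ sumR G ys ≡ []) ⇔ (sumL xs′ H ++ sumR G ys′ ≡ [])
options-empty⇔ {G} {H} {xs} {xs′} {ys} {ys′} xs⇔ ys⇔ =
  mk⇔ (transfer xs ys (to xs⇔) (to ys⇔)) (transfer xs′ ys′ (from xs⇔) (from ys⇔))
  where
  empty : ∀ {as bs} → as ≡ [] → bs ≡ [] → sumL as H ++ sumR G bs ≡ []
  empty refl refl = refl

  transfer : ∀ as bs {as′ bs′} → (as ≡ [] → as′ ≡ []) → (bs ≡ [] → bs′ ≡ []) →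
             sumL as H ++ sumR G bs ≡ [] → sumL as′ H ++ sumR G bs′ ≡ []
  transfer as bs f g e = empty (f (sumL-conical as H (++-conicalˡ _ _ e)))
                               (g (sumR-conical G bs (++-conicalʳ _ _ e)))

mutual
  Dicotic-⊕ : ∀ {G H} → Dicotic G → Dicotic H → Dicotic (G ⊕ H)
  Dicotic-⊕ dG@(dic iG dGL dGR) dH@(dic iH dHL dHR) =
    dic (options-empty⇔ iG iH)
        (All.++⁺ (Dicotic-sumL dGL dH) (Dicotic-sumR dG dHL))
        (All.++⁺ (Dicotic-sumL dGR dH) (Dicotic-sumR dG dHR))

  Dicotic-sumL : ∀ {xs H} → All Dicotic xs → Dicotic H → All Dicotic (sumL xs H)
  Dicotic-sumL []         dH = []
  Dicotic-sumL (dx ∷ dxs) dH = Dicotic-⊕ dx dH ∷ Dicotic-sumL dxs dH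

  Dicotic-sumR : ∀ {G ys} → Dicotic G → All Dicotic ys → All Dicotic (sumR G ys)
  Dicotic-sumR dG []         = []
  Dicotic-sumR dG (dy ∷ dys) = Dicotic-⊕ dG dy ∷ Dicotic-sumR dG dys

mutual
  Dicotic-neg : ∀ {G} → Dicotic G → Dicotic (neg G)
  Dicotic-neg (dic i dGL dGR) =
    dic (mk⇔ (cong negs ∘ from i ∘ negs-conical _) (cong negs ∘ to i ∘ negs-conical _))
        (Dicotic-negs dGR) (Dicotic-negs dGL)

  Dicotic-negs : ∀ {xs} → All Dicotic xs → All Dicotic (negs xs)
  Dicotic-negs []         = []
  Dicotic-negs (dx ∷ dxs) = Dicotic-neg dx ∷ Dicotic-negs dxs

conjₒ : Outcome → Outcome
conjₒ 𝓛 = 𝓡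
conjₒ 𝓝 = 𝓝
conjₒ 𝓟 = 𝓟
conjₒ 𝓡 = 𝓛

mutual
  leftFirst-neg : ∀ G → leftFirst (neg G) ≡ not (leftSecond G)
  leftFirst-neg ⟨ GL ∣ [] ⟩     = refl
  leftFirst-neg ⟨ GL ∣ r ∷ rs ⟩ = anyLeftSecond-negs (r ∷ rs)

  leftSecond-neg : ∀ G → leftSecond (neg G) ≡ not (leftFirst G)
  leftSecond-neg ⟨ [] ∣ GR ⟩     = refl
  leftSecond-neg ⟨ l ∷ ls ∣ GR ⟩ = allLeftFirst-negs (l ∷ ls)

  anyLeftSecond-negs : ∀ xs → anyLeftSecond (negs xs) ≡ not (allLeftFirst xs)
  anyLeftSecond-negs []       = refl
  anyLeftSecond-negs (x ∷ xs) =
    trans (cong₂ _∨_ (leftSecond-neg x) (anyLeftSecond-negs xs))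
          (sym (deMorgan₁ (leftFirst x) (allLeftFirst xs)))

  allLeftFirst-negs : ∀ xs → allLeftFirst (negs xs) ≡ not (anyLeftSecond xs)
  allLeftFirst-negs []       = refl
  allLeftFirst-negs (x ∷ xs) =
    trans (cong₂ _∧_ (leftFirst-neg x) (allLeftFirst-negs xs))
          (sym (deMorgan₂ (leftSecond x) (anyLeftSecond xs)))

outcomeOf-not : ∀ a b → outcomeOf (not b) (not a) ≡ conjₒ (outcomeOf a b)
outcomeOf-not true  true  = refl
outcomeOf-not true  false = refl
outcomeOf-not false true  = refl
outcomeOf-not false false = refl

o-neg : ∀ G → o (neg G) ≡ conjₒ (o G)
o-neg G = trans (cong₂ outcomeOf (leftFirst-neg G) (leftSecond-neg G))
                (outcomeOf-not (leftFirst G) (leftSecond G))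

conjₒ-antitone : ∀ {a b} → a ≥ₒ b → conjₒ b ≥ₒ conjₒ a
conjₒ-antitone ≥-refl = ≥-refl
conjₒ-antitone 𝓛≥𝓟   = 𝓟≥𝓡
conjₒ-antitone 𝓛≥𝓝   = 𝓝≥𝓡
conjₒ-antitone 𝓛≥𝓡   = 𝓛≥𝓡
conjₒ-antitone 𝓟≥𝓡   = 𝓛≥𝓟
conjₒ-antitone 𝓝≥𝓡   = 𝓛≥𝓝

≥ₒ-trans : ∀ {a b c} → a ≥ₒ b → b ≥ₒ c → a ≥ₒ c
≥ₒ-trans ≥-refl q      = q
≥ₒ-trans p      ≥-refl = p
≥ₒ-trans 𝓛≥𝓟   𝓟≥𝓡   = 𝓛≥𝓡
≥ₒ-trans 𝓛≥𝓝   𝓝≥𝓡   = 𝓛≥𝓡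

≥ₒ-antisym : ∀ {a b} → a ≥ₒ b → b ≥ₒ a → a ≡ b
≥ₒ-antisym ≥-refl _ = refl
≥ₒ-antisym 𝓛≥𝓟 ()
≥ₒ-antisym 𝓛≥𝓝 ()
≥ₒ-antisym 𝓛≥𝓡 ()
≥ₒ-antisym 𝓟≥𝓡 ()
≥ₒ-antisym 𝓝≥𝓡 ()

-- Bisimilarity, needed because ⊕ is commutative only up to the order of options

Matched : {A : Set} → (A → A → Set) → List A → List A → Set
Matched R xs ys = All (λ x → Any (R x) ys) xs

BiMatched : {A : Set} → (A → A → Set) → List A → List A → Set
BiMatched R xs ys = Matched R xs ys × Matched R ys xs

module _ {A : Set} {R : A → A → Set} where

  Pointwise⇒Matched : ∀ {xs ys} → Pointwise R xs ys → Matched R xs ys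
  Pointwise⇒Matched []       = []
  Pointwise⇒Matched (r ∷ rs) = here r ∷ All.map there (Pointwise⇒Matched rs)

  Pointwise⇒BiMatched : (∀ {x y} → R x y → R y x) →
                        ∀ {xs ys} → Pointwise R xs ys → BiMatched R xs ys
  Pointwise⇒BiMatched R-sym rs =
    Pointwise⇒Matched rs , Pointwise⇒Matched (Pointwise.symmetric R-sym rs)

  Matched-++ : ∀ {xs xs′ ys ys′} → Matched R xs ys → Matched R xs′ ys′ →
               Matched R (xs ++ xs′) (ys ++ ys′)
  Matched-++ {ys = ys} m m′ = All.++⁺ (All.map Any.++⁺ˡ m) (All.map (Any.++⁺ʳ ys) m′)

  Matched-++-swap : ∀ {xs xs′ ys ys′} → Matched R xs ys → Matched R xs′ ys′ →
                    Matched R (xs ++ xs′) (ys′ ++ ys)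
  Matched-++-swap {ys′ = ys′} m m′ = All.++⁺ (All.map (Any.++⁺ʳ ys′) m) (All.map Any.++⁺ˡ m′)

  BiMatched-++ : ∀ {xs xs′ ys ys′} → BiMatched R xs ys → BiMatched R xs′ ys′ →
                 BiMatched R (xs ++ xs′) (ys ++ ys′)
  BiMatched-++ (m , n) (m′ , n′) = Matched-++ m m′ , Matched-++ n n′

  BiMatched-++-swap : ∀ {xs xs′ ys ys′} → BiMatched R xs ys′ → BiMatched R xs′ ys →
                      BiMatched R (xs ++ xs′) (ys ++ ys′)
  BiMatched-++-swap (m , n) (m′ , n′) = Matched-++-swap m m′ , Matched-++-swap n′ n

infix 4 _~_
data _~_ : Game → Game → Set where
  sim : ∀ {GL GR HL HR} → BiMatched _~_ GL HL → BiMatched _~_ GR HR →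
        ⟨ GL ∣ GR ⟩ ~ ⟨ HL ∣ HR ⟩

~-sym : ∀ {G H} → G ~ H → H ~ G
~-sym (sim mL mR) = sim (swap mL) (swap mR)

T-ext : ∀ {x y} → (T x → T y) → (T y → T x) → x ≡ y
T-ext f g = ⇔→≡ {z = true} (mk⇔ (to T-≡ ∘ f ∘ from T-≡) (to T-≡ ∘ g ∘ from T-≡))

mutual
  leftFirst-resp-~ : ∀ {G H} → G ~ H → leftFirst G ≡ leftFirst H
  leftFirst-resp-~ {⟨ [] ∣ _ ⟩}    {⟨ [] ∣ _ ⟩}    _                    = refl
  leftFirst-resp-~ {⟨ [] ∣ _ ⟩}    {⟨ _ ∷ _ ∣ _ ⟩} (sim (_ , () ∷ _) _)
  leftFirst-resp-~ {⟨ _ ∷ _ ∣ _ ⟩} {⟨ [] ∣ _ ⟩}    (sim (() ∷ _ , _) _)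
  leftFirst-resp-~ {⟨ _ ∷ _ ∣ _ ⟩} {⟨ _ ∷ _ ∣ _ ⟩} (sim (m , n) _)      =
    T-ext (anyLeftSecond-Matched m) (anyLeftSecond-Matched n)

  leftSecond-resp-~ : ∀ {G H} → G ~ H → leftSecond G ≡ leftSecond H
  leftSecond-resp-~ {⟨ _ ∣ [] ⟩}    {⟨ _ ∣ [] ⟩}    _                    = refl
  leftSecond-resp-~ {⟨ _ ∣ [] ⟩}    {⟨ _ ∣ _ ∷ _ ⟩} (sim _ (_ , () ∷ _))
  leftSecond-resp-~ {⟨ _ ∣ _ ∷ _ ⟩} {⟨ _ ∣ [] ⟩}    (sim _ (() ∷ _ , _))
  leftSecond-resp-~ {⟨ _ ∣ _ ∷ _ ⟩} {⟨ _ ∣ _ ∷ _ ⟩} (sim _ (m , n))      =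
    T-ext (allLeftFirst-Matched n) (allLeftFirst-Matched m)

  anyLeftSecond-Matched : ∀ {xs ys} → Matched _~_ xs ys →
                          T (anyLeftSecond xs) → T (anyLeftSecond ys)
  anyLeftSecond-Matched []       ()
  anyLeftSecond-Matched (m ∷ ms) t =
    [ anyLeftSecond-Any m , anyLeftSecond-Matched ms ] (to T-∨ t)

  anyLeftSecond-Any : ∀ {x ys} → Any (x ~_) ys → T (leftSecond x) → T (anyLeftSecond ys)
  anyLeftSecond-Any (here p)  t = from T-∨ (inj₁ (subst T (leftSecond-resp-~ p) t))
  anyLeftSecond-Any (there a) t = from T-∨ (inj₂ (anyLeftSecond-Any a t))

  allLeftFirst-Matched : ∀ {xs ys} → Matched _~_ ys xs →
                         T (allLeftFirst xs) → T (allLeftFirst ys)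
  allLeftFirst-Matched []       _ = _
  allLeftFirst-Matched (m ∷ ms) t = from T-∧ (allLeftFirst-Any m t , allLeftFirst-Matched ms t)

  allLeftFirst-Any : ∀ {y xs} → Any (y ~_) xs → T (allLeftFirst xs) → T (leftFirst y)
  allLeftFirst-Any (here p)  t = subst T (sym (leftFirst-resp-~ p)) (proj₁ (to T-∧ t))
  allLeftFirst-Any (there a) t = allLeftFirst-Any a (proj₂ (to T-∧ t))

o-resp-~ : ∀ {G H} → G ~ H → o G ≡ o H
o-resp-~ p = cong₂ outcomeOf (leftFirst-resp-~ p) (leftSecond-resp-~ p)

options-~ : ∀ {xs ys} → Pointwise _~_ xs ys → BiMatched _~_ xs ys
options-~ = Pointwise⇒BiMatched ~-sym

mutual
  ⊕-comm-~ : ∀ G H → G ⊕ H ~ H ⊕ G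
  ⊕-comm-~ G@(⟨ GL ∣ GR ⟩) H@(⟨ HL ∣ HR ⟩) =
    sim (BiMatched-++-swap (options-~ (sumL-comm-~ GL H)) (options-~ (sumR-comm-~ G HL)))
        (BiMatched-++-swap (options-~ (sumL-comm-~ GR H)) (options-~ (sumR-comm-~ G HR)))

  sumL-comm-~ : ∀ xs H → Pointwise _~_ (sumL xs H) (sumR H xs)
  sumL-comm-~ []       H = []
  sumL-comm-~ (x ∷ xs) H = ⊕-comm-~ x H ∷ sumL-comm-~ xs H

  sumR-comm-~ : ∀ G ys → Pointwise _~_ (sumR G ys) (sumL ys G)
  sumR-comm-~ G []       = []
  sumR-comm-~ G (y ∷ ys) = ⊕-comm-~ G y ∷ sumR-comm-~ G ys

mutual
  ⊕-congˡ-~ : ∀ {G G′} → G ~ G′ → ∀ H → G ⊕ H ~ G′ ⊕ H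
  ⊕-congˡ-~ p@(sim (mL , nL) (mR , nR)) H@(⟨ HL ∣ HR ⟩) =
    sim (BiMatched-++ (Matched-sumL mL H , Matched-sumL nL H) (options-~ (sumR-congˡ-~ p HL)))
        (BiMatched-++ (Matched-sumL mR H , Matched-sumL nR H) (options-~ (sumR-congˡ-~ p HR)))

  sumR-congˡ-~ : ∀ {G G′} → G ~ G′ → ∀ ys → Pointwise _~_ (sumR G ys) (sumR G′ ys)
  sumR-congˡ-~ p []       = []
  sumR-congˡ-~ p (y ∷ ys) = ⊕-congˡ-~ p y ∷ sumR-congˡ-~ p ys

  Matched-sumL : ∀ {xs ys} → Matched _~_ xs ys → ∀ H → Matched _~_ (sumL xs H) (sumL ys H)
  Matched-sumL []       H = []
  Matched-sumL (a ∷ ms) H = Any-sumL a H ∷ Matched-sumL ms H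

  Any-sumL : ∀ {x ys} → Any (x ~_) ys → ∀ H → Any (x ⊕ H ~_) (sumL ys H)
  Any-sumL (here p)  H = here (⊕-congˡ-~ p H)
  Any-sumL (there a) H = there (Any-sumL a H)

≽-trans : ∀ {G H K} → G ≽ H → H ≽ K → G ≽ K
≽-trans G≽H H≽K X dX = ≥ₒ-trans (G≽H X dX) (H≽K X dX)

≽-antisym : ∀ {G H} → G ≽ H → H ≽ G → G ≈D H
≽-antisym G≽H H≽G X dX = ≥ₒ-antisym (G≽H X dX) (H≽G X dX)

≽-respˡ-~ : ∀ {G G′ H} → G ~ G′ → G ≽ H → G′ ≽ H
≽-respˡ-~ {H = H} p G≽H X dX =
  subst (_≥ₒ o (H ⊕ X)) (o-resp-~ (⊕-congˡ-~ p X)) (G≽H X dX)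

⊕-monoˡ-≽ : ∀ {G H K} → Dicotic K → G ≽ H → G ⊕ K ≽ H ⊕ K
⊕-monoˡ-≽ {G} {H} {K} dK G≽H X dX =
  subst₂ _≥ₒ_ (cong o (sym (⊕-assoc G K X))) (cong o (sym (⊕-assoc H K X)))
         (G≽H (K ⊕ X) (Dicotic-⊕ dK dX))

o-neg-⊕-neg : ∀ G X → conjₒ (o (G ⊕ neg X)) ≡ o (neg G ⊕ X)
o-neg-⊕-neg G X = begin
    conjₒ (o (G ⊕ neg X))     ≡⟨ sym (o-neg (G ⊕ neg X)) ⟩
    o (neg (G ⊕ neg X))       ≡⟨ cong o (neg-distrib-⊕ G (neg X)) ⟩
    o (neg G ⊕ neg (neg X))   ≡⟨ cong (o ∘ (neg G ⊕_)) (neg-involutive X) ⟩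
    o (neg G ⊕ X)             ∎
  where open ≡-Reasoning

neg-antimono-≽ : ∀ {G H} → G ≽ H → neg H ≽ neg G
neg-antimono-≽ {G} {H} G≽H X dX =
  subst₂ _≥ₒ_ (o-neg-⊕-neg H X) (o-neg-⊕-neg G X)
         (conjₒ-antitone (G≽H (neg X) (Dicotic-neg dX)))

-- neg zeroG reduces to zeroG, so neg-antimono-≽ lands directly in _ ≽ zeroG.
difference-≼0⇒≽0 : ∀ H → zeroG ≽ H ⊕ neg H → H ⊕ neg H ≽ zeroG
difference-≼0⇒≽0 H 0≽K = ≽-respˡ-~ {H = zeroG} neg-K~K (neg-antimono-≽ {zeroG} {H ⊕ neg H} 0≽K)
  where
  neg-K≡ : neg (H ⊕ neg H) ≡ neg H ⊕ H
  neg-K≡ = trans (neg-distrib-⊕ H (neg H)) (cong (neg H ⊕_) (neg-involutive H))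

  neg-K~K : neg (H ⊕ neg H) ~ H ⊕ neg H
  neg-K~K = subst (_~ H ⊕ neg H) (sym neg-K≡) (⊕-comm-~ (neg H) H)

mainTheorem1 : (G H : Game) → Dicotic G → Dicotic H →
    G ≻ zeroG → ¬ ((G ⊕ H) ⊕ neg H ≺ zeroG)
mainTheorem1 G H _ dH (G≽0 , _) (0≽J , 0≉J) = 0≉J (≽-antisym {zeroG} {J} 0≽J J≽0)
  where
  K J : Game
  K = H ⊕ neg H
  J = (G ⊕ H) ⊕ neg H

  J≽K : J ≽ K
  J≽K = subst₂ _≽_ (sym (⊕-assoc G H (neg H))) (⊕-identityˡ K)
                   (⊕-monoˡ-≽ {G} {zeroG} (Dicotic-⊕ dH (Dicotic-neg dH)) G≽0)

  K≽0 : K ≽ zeroG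
  K≽0 = difference-≼0⇒≽0 H (≽-trans {zeroG} {J} {K} 0≽J J≽K)

  J≽0 : J ≽ zeroG
  J≽0 = ≽-trans {J} {K} {zeroG} J≽K K≽0
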